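{- Let $G$ be a graph on $n\ge 5$ vertices such that $\chi_s(G)=\Delta(G)=n-1$. Then $G$ is not $(n-1)$-critical.
   Context: Standing assumption of the paper: all graphs are finite, undirected, simple and connected. $\Delta(G)$ is the maximum degree. A star coloring of $G$ is a proper vertex-coloring such that no path on four vertices (as a subgraph) is colored with only two colors; $\chi_s(G)$ is the minimum number of colors in a star coloring of $G$. $G$ is $k$-critical if $\chi_s(G)=k$ and $\chi_s(G-e)<\chi_s(G)$ for every edge $e$, where $G-e$ denotes deletion of the edge $e$. -}

module Defs where

open import Data.Nat using (ℕ; _≤_; _<_; _⊔_)
open import Data.Fin using (Fin; _≟_)
open import Data.Bool using (Bool; true; false; _∧_; _∨_; not; T)
open import Data.Bool.Properties using (∧-comm; ∨-comm)
open import Data.List using (List; length; filter; map; foldr; allFin)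
open import Data.Product using (Σ; ∃; ∃-syntax; _×_; _,_)
open import Data.Sum using (_⊎_)
open import Relation.Nullary using (¬_)
open import Relation.Nullary.Decidable using (⌊_⌋; T?)
open import Relation.Binary.PropositionalEquality using (_≡_; refl; cong; cong₂)
open import Relation.Binary.Construct.Closure.ReflexiveTransitive using (Star)

record Graph (n : ℕ) : Set where
  field
    adj     : Fin n → Fin n → Bool
    adj-sym : ∀ x y → adj x y ≡ adj y x
    adj-irr : ∀ x → adj x x ≡ false
open Graph public

Adj : ∀ {n} → Graph n → Fin n → Fin n → Set
Adj G x y = T (adj G x y)

Connected : ∀ {n} → Graph n → Set
Connected G = ∀ x y → Star (Adj G) x y

degree : ∀ {n} → Graph n → Fin n → ℕ
degree G v = length (filter (λ w → T? (adj G v w)) (allFin _))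

Δ : ∀ {n} → Graph n → ℕ
Δ G = foldr _⊔_ 0 (map (degree G) (allFin _))

private
  isPair : ∀ {n} → Fin n → Fin n → Fin n → Fin n → Bool
  isPair u v x y = (⌊ x ≟ u ⌋ ∧ ⌊ y ≟ v ⌋) ∨ (⌊ x ≟ v ⌋ ∧ ⌊ y ≟ u ⌋)

  isPair-sym : ∀ {n} (u v x y : Fin n) → isPair u v x y ≡ isPair u v y x
  isPair-sym u v x y
    rewrite ∧-comm ⌊ x ≟ u ⌋ ⌊ y ≟ v ⌋ | ∧-comm ⌊ x ≟ v ⌋ ⌊ y ≟ u ⌋
    = ∨-comm (⌊ y ≟ v ⌋ ∧ ⌊ x ≟ u ⌋) (⌊ y ≟ u ⌋ ∧ ⌊ x ≟ v ⌋)

deleteEdge : ∀ {n} → Graph n → Fin n → Fin n → Graph n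
deleteEdge G u v = record
  { adj     = λ x y → adj G x y ∧ not (isPair u v x y)
  ; adj-sym = λ x y → cong₂ _∧_ (adj-sym G x y) (cong not (isPair-sym u v x y))
  ; adj-irr = λ x → cong (_∧ not (isPair u v x x)) (adj-irr G x)
  }

record StarColoring {n} (G : Graph n) (k : ℕ) : Set where
  field
    color  : Fin n → Fin k
    proper : ∀ x y → Adj G x y → ¬ (color x ≡ color y)
    noBicoloredP4 : ∀ a b c d →
      ¬ (a ≡ b) → ¬ (a ≡ c) → ¬ (a ≡ d) → ¬ (b ≡ c) → ¬ (b ≡ d) → ¬ (c ≡ d) →
      Adj G a b → Adj G b c → Adj G c d →
      ¬ (Σ (Fin k) λ p → Σ (Fin k) λ q →
           ((color a ≡ p) ⊎ (color a ≡ q)) × ((color b ≡ p) ⊎ (color b ≡ q)) ×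
           ((color c ≡ p) ⊎ (color c ≡ q)) × ((color d ≡ p) ⊎ (color d ≡ q)))

StarChromaticNumber : ∀ {n} → Graph n → ℕ → Set
StarChromaticNumber G k = StarColoring G k × (∀ m → StarColoring G m → k ≤ m)

Critical : ∀ {n} → Graph n → ℕ → Set
Critical G k = StarChromaticNumber G k ×
  (∀ u v → Adj G u v → ∃[ m ] (StarChromaticNumber (deleteEdge G u v) m × m < k))

{-# OPTIONS --safe #-}
module Submission where

-- Δ(G) = n − 1 yields a vertex v adjacent to every other vertex, so in any
-- proper colouring of G the colour of v is used only on v, and no 2-coloured
-- P4 can pass through v.  Take an edge vw; criticality gives a star colouring c
-- of G − vw with m < n − 1 colours.  If c(v) ≠ c(w), c is already a star
-- colouring of G.  If c(v) = c(w), two vertices a, b ≠ v share a colour by the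
-- pigeonhole principle, and w has no neighbour x ≠ v whose colour is repeated
-- on some y ∉ {v, w}, for otherwise x v y w would be a 2-coloured P4 of G − vw.
-- Hence recolouring w with c(a) gives a star colouring of G.  Either way
-- χs(G) ≤ m < n − 1.

open import Defs
open import Data.Nat using (ℕ; suc; _+_; _≤_; _<_; _∸_; z≤n; s≤s)
open import Data.Nat.Properties using (⊔-sel; <-irrefl; <⇒≱; 1+n≰n; ≤-pred; m≤n⇒m≤1+n)
open import Data.Fin using (Fin; zero; _≟_; punchIn)
open import Data.Fin.Properties using (pigeonhole; punchIn-injective; punchInᵢ≢i; <⇒≢)
open import Data.Bool using (true; false; T)
open import Data.Unit using (tt)
open import Data.List using (_∷_; length; filter; map; allFin)
open import Data.List.Properties using (filter-notAll; length-tabulate)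
open import Data.List.Membership.Propositional using (_∈_)
open import Data.List.Membership.Propositional.Properties using (∈-allFin; ∈-map⁻; foldr-selective)
open import Data.List.Relation.Unary.Any as Any using (here; there)
open import Data.Vec.Functional using (updateAt)
open import Data.Vec.Functional.Properties using (updateAt-updates; updateAt-minimal)
open import Data.Product using (Σ; ∃; _×_; _,_)
open import Data.Sum using (_⊎_; inj₁; inj₂)
open import Data.Empty using (⊥-elim)
open import Function using (_∘_; const; id)
open import Level using (0ℓ)
open import Relation.Nullary using (¬_; yes; no)
open import Relation.Nullary.Decidable using (T?)
open import Relation.Unary using (Pred; Decidable)
open import Relation.Binary.PropositionalEquality
  using (_≡_; _≢_; refl; sym; trans; subst; subst₂; ≢-sym)

module _ {A : Set} {P : Pred A 0ℓ} (P? : Decidable P) where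

  length-filter-reject₂ : ∀ {a b} xs → a ∈ xs → b ∈ xs → a ≢ b → ¬ P a → ¬ P b →
                          2 + length (filter P? xs) ≤ length xs
  length-filter-reject₂ (x ∷ xs) (here refl) (here refl) a≢b _ _ = ⊥-elim (a≢b refl)
  length-filter-reject₂ (x ∷ xs) (here refl) (there b∈xs) _ ¬Pa ¬Pb with P? x
  ... | yes Pa = ⊥-elim (¬Pa Pa)
  ... | no _   = s≤s (filter-notAll P? xs (Any.map (λ { refl → ¬Pb }) b∈xs))
  length-filter-reject₂ (x ∷ xs) (there a∈xs) (here refl) _ ¬Pa ¬Pb with P? x
  ... | yes Pb = ⊥-elim (¬Pb Pb)
  ... | no _   = s≤s (filter-notAll P? xs (Any.map (λ { refl → ¬Pa }) a∈xs))
  length-filter-reject₂ (x ∷ xs) (there a∈xs) (there b∈xs) a≢b ¬Pa ¬Pb with P? x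
  ... | yes _ = s≤s (length-filter-reject₂ xs a∈xs b∈xs a≢b ¬Pa ¬Pb)
  ... | no _  = m≤n⇒m≤1+n (length-filter-reject₂ xs a∈xs b∈xs a≢b ¬Pa ¬Pb)

Adj-sym : ∀ {n} (G : Graph n) {x y} → Adj G x y → Adj G y x
Adj-sym G {x} {y} = subst T (adj-sym G x y)

Dominating : ∀ {n} → Graph n → Fin n → Set
Dominating G v = ∀ x → x ≢ v → Adj G v x

Δ-attained : ∀ {n} (G : Graph n) → 0 < Δ G → ∃ λ v → degree G v ≡ Δ G
Δ-attained G 0<Δ with foldr-selective ⊔-sel 0 (map (degree G) (allFin _))
... | inj₁ Δ≡0 = ⊥-elim (<-irrefl (sym Δ≡0) 0<Δ)
... | inj₂ Δ∈degrees with ∈-map⁻ (degree G) Δ∈degrees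
...   | v , _ , Δ≡dv = v , sym Δ≡dv

degree-full⇒dominating : ∀ {k} (G : Graph (suc k)) v → degree G v ≡ k → Dominating G v
degree-full⇒dominating {k} G v deg x x≢v with adj G v x in vx
... | true  = tt
... | false = 1+n≰n (≤-pred (subst₂ (λ d l → 2 + d ≤ l) deg (length-tabulate id) tooFew))
  where
  tooFew : 2 + degree G v ≤ length (allFin (suc k))
  tooFew = length-filter-reject₂ (λ u → T? (adj G v u)) (allFin _) (∈-allFin v) (∈-allFin x)
             (≢-sym x≢v) (subst T (adj-irr G v)) (subst T vx)

dominatingVertex : ∀ {k} (G : Graph (suc (suc k))) → Δ G ≡ suc k → ∃ (Dominating G)
dominatingVertex G Δ≡ with Δ-attained G (subst (0 <_) (sym Δ≡) (s≤s z≤n))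
... | v , dv≡Δ = v , degree-full⇒dominating G v (trans dv≡Δ Δ≡)

module _ {n : ℕ} (G : Graph n) {u w : Fin n} where

  Adj⇒deleteEdge⊎deleted : ∀ {x y} → Adj G x y →
    Adj (deleteEdge G u w) x y ⊎ (x ≡ u × y ≡ w) ⊎ (x ≡ w × y ≡ u)
  Adj⇒deleteEdge⊎deleted {x} {y} xy with adj G x y | x ≟ u | y ≟ w | x ≟ w | y ≟ u
  ... | true | yes p | yes q | _     | _     = inj₂ (inj₁ (p , q))
  ... | true | _     | _     | yes p | yes q = inj₂ (inj₂ (p , q))
  ... | true | no _  | _     | no _  | _     = inj₁ tt
  ... | true | no _  | _     | yes _ | no _  = inj₁ tt
  ... | true | yes _ | no _  | no _  | _     = inj₁ tt
  ... | true | yes _ | no _  | yes _ | no _  = inj₁ tt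

  Adj-deleteEdge⁺ : ∀ {x y} → Adj G x y → ¬ (x ≡ u × y ≡ w) → ¬ (x ≡ w × y ≡ u) →
                    Adj (deleteEdge G u w) x y
  Adj-deleteEdge⁺ xy ¬uw ¬wu with Adj⇒deleteEdge⊎deleted xy
  ... | inj₁ xy′       = xy′
  ... | inj₂ (inj₁ uw) = ⊥-elim (¬uw uw)
  ... | inj₂ (inj₂ wu) = ⊥-elim (¬wu wu)

  Adj-deleteEdge-avoidingˡ : ∀ {x y} → x ≢ u → y ≢ u → Adj G x y → Adj (deleteEdge G u w) x y
  Adj-deleteEdge-avoidingˡ x≢u y≢u xy =
    Adj-deleteEdge⁺ xy (x≢u ∘ λ (e , _) → e) (y≢u ∘ λ (_ , e) → e)

  Adj-deleteEdge-avoidingʳ : ∀ {x y} → x ≢ w → y ≢ w → Adj G x y → Adj (deleteEdge G u w) x y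
  Adj-deleteEdge-avoidingʳ x≢w y≢w xy =
    Adj-deleteEdge⁺ xy (y≢w ∘ λ (_ , e) → e) (x≢w ∘ λ (e , _) → e)

Proper : ∀ {n k} → Graph n → (Fin n → Fin k) → Set
Proper G col = ∀ x y → Adj G x y → col x ≢ col y

Bicolored : ∀ {n k} → (Fin n → Fin k) → (a b c d : Fin n) → Set
Bicolored {k = k} col a b c d = Σ (Fin k) λ p → Σ (Fin k) λ q →
  ((col a ≡ p) ⊎ (col a ≡ q)) × ((col b ≡ p) ⊎ (col b ≡ q)) ×
  ((col c ≡ p) ⊎ (col c ≡ q)) × ((col d ≡ p) ⊎ (col d ≡ q))

record IsP4 {n} (G : Graph n) (a b c d : Fin n) : Set where
  constructor isP4
  field
    a≢b : a ≢ b
    a≢c : a ≢ c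
    a≢d : a ≢ d
    b≢c : b ≢ c
    b≢d : b ≢ d
    c≢d : c ≢ d
    ab  : Adj G a b
    bc  : Adj G b c
    cd  : Adj G c d
open IsP4

module _ {n k : ℕ} {G : Graph n} where

  starColoring : (col : Fin n → Fin k) → Proper G col →
                 (∀ {a b c d} → IsP4 G a b c d → ¬ Bicolored col a b c d) → StarColoring G k
  starColoring col proper noP4 = record
    { color         = col
    ; proper        = proper
    ; noBicoloredP4 = λ _ _ _ _ a≢b a≢c a≢d b≢c b≢d c≢d ab bc cd →
                        noP4 (isP4 a≢b a≢c a≢d b≢c b≢d c≢d ab bc cd)
    }

  starColoring⇒¬bicolored : (σ : StarColoring G k) → ∀ {a b c d} → IsP4 G a b c d →
                            ¬ Bicolored (StarColoring.color σ) a b c d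
  starColoring⇒¬bicolored σ (isP4 a≢b a≢c a≢d b≢c b≢d c≢d ab bc cd) =
    StarColoring.noBicoloredP4 σ _ _ _ _ a≢b a≢c a≢d b≢c b≢d c≢d ab bc cd

twoColored-alternates : ∀ {A : Set} {x y z p q : A} →
  x ≡ p ⊎ x ≡ q → y ≡ p ⊎ y ≡ q → z ≡ p ⊎ z ≡ q → x ≢ y → y ≢ z → x ≡ z
twoColored-alternates (inj₁ refl) (inj₁ refl) _           x≢y _   = ⊥-elim (x≢y refl)
twoColored-alternates (inj₂ refl) (inj₂ refl) _           x≢y _   = ⊥-elim (x≢y refl)
twoColored-alternates _           (inj₁ refl) (inj₁ refl) _   y≢z = ⊥-elim (y≢z refl)
twoColored-alternates _           (inj₂ refl) (inj₂ refl) _   y≢z = ⊥-elim (y≢z refl)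
twoColored-alternates (inj₁ refl) (inj₂ refl) (inj₁ refl) _   _   = refl
twoColored-alternates (inj₂ refl) (inj₁ refl) (inj₂ refl) _   _   = refl

bicolored-alternates : ∀ {n k} {G : Graph n} {col : Fin n → Fin k} {a b c d} → Proper G col →
  IsP4 G a b c d → Bicolored col a b c d → col a ≡ col c × col b ≡ col d
bicolored-alternates proper p (_ , _ , ia , ib , ic , id) =
  twoColored-alternates ia ib ic (proper _ _ (ab p)) (proper _ _ (bc p)) ,
  twoColored-alternates ib ic id (proper _ _ (bc p)) (proper _ _ (cd p))

module _ {n k : ℕ} {G : Graph n} {v} (dom : Dominating G v)
         {col : Fin n → Fin k} (proper : Proper G col) where

  dominating-uniqueColor : ∀ {x} → x ≢ v → col x ≢ col v
  dominating-uniqueColor {x} x≢v cx≡cv = proper v x (dom x x≢v) (sym cx≡cv)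

  starColoring-avoiding :
    (∀ {a b c d} → IsP4 G a b c d → a ≢ v → b ≢ v → c ≢ v → d ≢ v → ¬ Bicolored col a b c d) →
    StarColoring G k
  starColoring-avoiding noP4 = starColoring col proper noP4′
    where
    noP4′ : ∀ {a b c d} → IsP4 G a b c d → ¬ Bicolored col a b c d
    noP4′ {a} {b} {c} {d} p bic
      with bicolored-alternates proper p bic | a ≟ v | b ≟ v | c ≟ v | d ≟ v
    ... | ac , _ | yes refl | _        | _        | _        =
      dominating-uniqueColor (≢-sym (a≢c p)) (sym ac)
    ... | _ , bd | no _     | yes refl | _        | _        =
      dominating-uniqueColor (≢-sym (b≢d p)) (sym bd)
    ... | ac , _ | no _     | no _     | yes refl | _        = dominating-uniqueColor (a≢c p) ac
    ... | _ , bd | no _     | no _     | no _     | yes refl = dominating-uniqueColor (b≢d p) bd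
    ... | _      | no a≢v   | no b≢v   | no c≢v   | no d≢v   = noP4 p a≢v b≢v c≢v d≢v bic

bicolored-resp : ∀ {n k} {col col′ : Fin n → Fin k} {a b c d} →
  col a ≡ col′ a → col b ≡ col′ b → col c ≡ col′ c → col d ≡ col′ d →
  Bicolored col a b c d → Bicolored col′ a b c d
bicolored-resp ea eb ec ed (p , q , ia , ib , ic , id) =
  p , q , move ea ia , move eb ib , move ec ic , move ed id
  where
  move : ∀ {x y} → x ≡ y → x ≡ p ⊎ x ≡ q → y ≡ p ⊎ y ≡ q
  move refl = λ e → e

IsP4-deleteEdge-avoiding : ∀ {n} {G : Graph n} {u w a b c d} → IsP4 G a b c d →
  a ≢ u → b ≢ u → c ≢ u → d ≢ u → IsP4 (deleteEdge G u w) a b c d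
IsP4-deleteEdge-avoiding {G = G} (isP4 a≢b a≢c a≢d b≢c b≢d c≢d ab bc cd) a≢u b≢u c≢u d≢u =
  isP4 a≢b a≢c a≢d b≢c b≢d c≢d
    (Adj-deleteEdge-avoidingˡ G a≢u b≢u ab)
    (Adj-deleteEdge-avoidingˡ G b≢u c≢u bc)
    (Adj-deleteEdge-avoidingˡ G c≢u d≢u cd)

module _ {n m : ℕ} {G : Graph n} {v w : Fin n} (v≢w : v ≢ w) (dom : Dominating G v)
         (σ : StarColoring (deleteEdge G v w) m) where

  private
    c = StarColoring.color σ

    adj-v : ∀ {x} → x ≢ v → x ≢ w → Adj (deleteEdge G v w) v x
    adj-v x≢v x≢w = Adj-deleteEdge-avoidingʳ G v≢w x≢w (dom _ x≢v)

  restoreEdge-distinct : c v ≢ c w → StarColoring G m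
  restoreEdge-distinct cv≢cw = starColoring-avoiding dom proper noP4
    where
    proper : Proper G c
    proper x y xy with Adj⇒deleteEdge⊎deleted G xy
    ... | inj₁ xy′                  = StarColoring.proper σ x y xy′
    ... | inj₂ (inj₁ (refl , refl)) = cv≢cw
    ... | inj₂ (inj₂ (refl , refl)) = ≢-sym cv≢cw

    noP4 : ∀ {a b c′ d} → IsP4 G a b c′ d → a ≢ v → b ≢ v → c′ ≢ v → d ≢ v →
           ¬ Bicolored c a b c′ d
    noP4 p a≢v b≢v c≢v d≢v =
      starColoring⇒¬bicolored σ (IsP4-deleteEdge-avoiding p a≢v b≢v c≢v d≢v)

  module _ (cv≡cw : c v ≡ c w) where

    repeatedColor-¬adj-w : ∀ {x y} → x ≢ y → x ≢ v → y ≢ v → x ≢ w → y ≢ w → c x ≡ c y →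
                           ¬ Adj G y w
    repeatedColor-¬adj-w {x} x≢y x≢v y≢v x≢w y≢w cx≡cy yw =
      starColoring⇒¬bicolored σ
        (isP4 x≢v x≢y x≢w (≢-sym y≢v) v≢w y≢w
          (Adj-sym (deleteEdge G v w) (adj-v x≢v x≢w)) (adj-v y≢v y≢w)
          (Adj-deleteEdge-avoidingˡ G y≢v (≢-sym v≢w) yw))
        (c x , c v , inj₁ refl , inj₂ refl , inj₁ (sym cx≡cy) , inj₂ (sym cv≡cw))

    module _ {a b} (a≢b : a ≢ b) (a≢v : a ≢ v) (b≢v : b ≢ v) (ca≡cb : c a ≡ c b) where

      private
        a≢w : a ≢ w
        a≢w refl = StarColoring.proper σ v b (adj-v b≢v (≢-sym a≢b)) (trans cv≡cw ca≡cb)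

        b≢w : b ≢ w
        b≢w refl = StarColoring.proper σ v a (adj-v a≢v a≢b) (trans cv≡cw (sym ca≡cb))

        c′ : Fin n → Fin m
        c′ = updateAt c w (const (c a))

        c′-w : c′ w ≡ c a
        c′-w = updateAt-updates w c

        c′-other : ∀ {x} → x ≢ w → c′ x ≡ c x
        c′-other {x} x≢w = updateAt-minimal x w c x≢w

        ca≢color-neighbour-w : ∀ {y} → y ≢ w → Adj G w y → c a ≢ c y
        ca≢color-neighbour-w {y} y≢w wy ca≡cy with y ≟ v | y ≟ a
        ... | yes refl | _        = StarColoring.proper σ v a (adj-v a≢v a≢w) (sym ca≡cy)
        ... | no _     | yes refl =
          repeatedColor-¬adj-w (≢-sym a≢b) b≢v a≢v b≢w a≢w (sym ca≡cb) (Adj-sym G wy)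
        ... | no y≢v   | no y≢a   =
          repeatedColor-¬adj-w (≢-sym y≢a) a≢v y≢v a≢w y≢w ca≡cy (Adj-sym G wy)

        proper′ : Proper G c′
        proper′ x y xy with x ≟ w | y ≟ w
        ... | yes refl | yes refl = λ _ → subst T (adj-irr G w) xy
        ... | yes refl | no y≢w   = λ c′w≡c′y →
          ca≢color-neighbour-w y≢w xy (trans (sym c′-w) (trans c′w≡c′y (c′-other y≢w)))
        ... | no x≢w   | yes refl = λ c′x≡c′w →
          ca≢color-neighbour-w x≢w (Adj-sym G xy)
            (trans (sym c′-w) (trans (sym c′x≡c′w) (c′-other x≢w)))
        ... | no x≢w   | no y≢w   = λ c′x≡c′y →
          StarColoring.proper σ x y (Adj-deleteEdge-avoidingʳ G x≢w y≢w xy)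
            (trans (sym (c′-other x≢w)) (trans c′x≡c′y (c′-other y≢w)))

        repeatedColor-¬adj-w′ : ∀ {x y} → x ≢ y → x ≢ v → y ≢ v → x ≢ w → y ≢ w → c′ x ≡ c′ y →
                                ¬ Adj G w x
        repeatedColor-¬adj-w′ x≢y x≢v y≢v x≢w y≢w c′x≡c′y wx =
          repeatedColor-¬adj-w (≢-sym x≢y) y≢v x≢v y≢w x≢w
            (trans (sym (c′-other y≢w)) (trans (sym c′x≡c′y) (c′-other x≢w))) (Adj-sym G wx)

        noP4′ : ∀ {a′ b′ c″ d′} → IsP4 G a′ b′ c″ d′ → a′ ≢ v → b′ ≢ v → c″ ≢ v → d′ ≢ v →
                ¬ Bicolored c′ a′ b′ c″ d′
        noP4′ {a′} {b′} {c″} {d′} p a′≢v b′≢v c″≢v d′≢v bic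
          with bicolored-alternates proper′ p bic | a′ ≟ w | b′ ≟ w | c″ ≟ w | d′ ≟ w
        ... | _ , bd | yes refl | _        | _        | _        =
          repeatedColor-¬adj-w′ (b≢d p) b′≢v d′≢v (≢-sym (IsP4.a≢b p)) (≢-sym (a≢d p)) bd (ab p)
        ... | ac , _ | no a′≢w  | yes refl | _        | _        =
          repeatedColor-¬adj-w′ (≢-sym (a≢c p)) c″≢v a′≢v (≢-sym (b≢c p)) a′≢w (sym ac) (bc p)
        ... | _ , bd | no _     | no b′≢w  | yes refl | _        =
          repeatedColor-¬adj-w′ (b≢d p) b′≢v d′≢v b′≢w (≢-sym (c≢d p)) bd (Adj-sym G (bc p))
        ... | ac , _ | no a′≢w  | no _     | no c″≢w  | yes refl =
          repeatedColor-¬adj-w′ (≢-sym (a≢c p)) c″≢v a′≢v c″≢w a′≢w (sym ac) (Adj-sym G (cd p))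
        ... | _      | no a′≢w  | no b′≢w  | no c″≢w  | no d′≢w  =
          starColoring⇒¬bicolored σ (IsP4-deleteEdge-avoiding p a′≢v b′≢v c″≢v d′≢v)
            (bicolored-resp {col = c′} {c}
              (c′-other a′≢w) (c′-other b′≢w) (c′-other c″≢w) (c′-other d′≢w) bic)

      restoreEdge-recolor : StarColoring G m
      restoreEdge-recolor = starColoring-avoiding dom proper′ noP4′

starColoring-restoreEdge : ∀ {k m} {G : Graph (suc k)} {v w} → Dominating G v → v ≢ w → m < k →
                           StarColoring (deleteEdge G v w) m → StarColoring G m
starColoring-restoreEdge {v = v} {w} dom v≢w m<k σ
  with StarColoring.color σ v ≟ StarColoring.color σ w
... | no cv≢cw = restoreEdge-distinct v≢w dom σ cv≢cw
... | yes cv≡cw with pigeonhole m<k (StarColoring.color σ ∘ punchIn v)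
...   | i , j , i<j , ci≡cj =
  restoreEdge-recolor v≢w dom σ cv≡cw (<⇒≢ i<j ∘ punchIn-injective v i j)
    (punchInᵢ≢i v i) (punchInᵢ≢i v j) ci≡cj

mainTheorem11 : (n : ℕ) → 5 ≤ n → (G : Graph n) → Connected G →
    StarChromaticNumber G (n ∸ 1) → Δ G ≡ n ∸ 1 → ¬ Critical G (n ∸ 1)
mainTheorem11 (suc (suc k)) (s≤s (s≤s _)) G _ (_ , minimal) Δ≡ (_ , critical)
  with dominatingVertex G Δ≡
... | v , dom with critical v (punchIn v zero) (dom _ (punchInᵢ≢i v zero))
...   | m , (σ , _) , m<n−1 =
  <⇒≱ m<n−1 (minimal m (starColoring-restoreEdge dom (≢-sym (punchInᵢ≢i v zero)) m<n−1 σ))
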